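{- Let $\mathcal{M}=(E,\mathcal{C})$ be a loopless oriented matroid with ground set $E=\{e_1,\dots,e_m\}$ totally ordered by $e_1\prec\cdots\prec e_m$, and $E_k=\{e_1,\dots,e_k\}$. For $N\subseteq E_k$ write $N^c=E_k-N$. Let $\mathscr{N}_k$ be the set of pairs $(N_k,A_k)$ with $N_k\subseteq E_k$, $A_k\subseteq E-E_k$, $N_k$ an NBC subset of $\underline{\mathcal{M}}$, and $\mathcal{M}_k:={}_{ -A_k}(\mathcal{M}\backslash N_k^c/N_k)$ acyclic. For $1\le k\le m$ define $\psi_k:\mathscr{N}_{k-1}\to\mathscr{N}_k$ by $$\psi_k(N_{k-1},A_{k-1})=\begin{cases}(N_{k-1}\cup\{e_k\},A_{k-1}) & \text{if } e_k\notin A_{k-1}\text{ and } {}_{ -\{e_k\}}\mathcal{M}_{k-1}\text{ is acyclic};\\ (N_{k-1},A_{k-1}) & \text{if } e_k\notin A_{k-1}\text{ and } {}_{ -\{e_k\}}\mathcal{M}_{k-1}\text{ is not acyclic};\\ (N_{k-1},A_{k-1}-\{e_k\}) & \text{if } e_k\in A_{k-1},\end{cases}$$ where $\mathcal{M}_{k-1}={}_{ -A_{k-1}}(\mathcal{M}\backslash N_{k-1}^c/N_{k-1})$. Then $\psi_k$ is injective.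
   Context: Signed circuits $X=(X^+,X^-)$, support $\underline{X}=X^+\cup X^-$; positive circuit: $X^-=\emptyset$; acyclic: no positive circuits. The underlying matroid $\underline{\mathcal{M}}$ has circuits $\{\underline{X}:X\in\mathcal{C}\}$. A broken circuit is a circuit of $\underline{\mathcal{M}}$ minus its $\prec$-maximal element; an NBC subset contains no broken circuit. Reorientation ${}_{ -A}\mathcal{M}$ has signed circuits $((X^+-A)\cup(X^-\cap A),(X^--A)\cup(X^+\cap A))$. Deletion $\mathcal{M}\backslash S$: signed circuits $Y$ with $\underline{Y}\subseteq E-S$; contraction $\mathcal{M}/S$: support-minimal nonempty members of $\{(Y^+-S,Y^--S):Y\in\mathcal{C}\}$. (That $\psi_k$ maps $\mathscr{N}_{k-1}$ into $\mathscr{N}_k$ is part of the setting.) -}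

module Defs where

open import Data.Nat using (ℕ; suc; _<ᵇ_; _≤_)
open import Data.Fin using (Fin; toℕ)
open import Data.Fin.Subset
  using (Subset; _∈_; _∉_; _⊆_; ∁; _∩_; _∪_; _─_; _-_; ⁅_⁆; Nonempty; Empty)
open import Data.Vec using (tabulate)
open import Data.Product using (Σ; ∃; _×_; _,_; proj₁; proj₂)
open import Data.Sum using (_⊎_)
open import Relation.Nullary using (¬_)
open import Relation.Binary.PropositionalEquality using (_≡_; _≢_)

-- Ground set E = {e₁,…,eₘ} is Fin m, with eᵢ the element of index i-1;
-- the total order ≺ is the natural order of Fin m.

SignedSet : ℕ → Set
SignedSet m = Subset m × Subset m

module _ {m : ℕ} where

  _⁺ _⁻ : SignedSet m → Subset m
  X ⁺ = proj₁ X
  X ⁻ = proj₂ X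

  support : SignedSet m → Subset m
  support X = X ⁺ ∪ X ⁻

  negate : SignedSet m → SignedSet m
  negate X = (X ⁻ , X ⁺)

Circuits : ℕ → Set₁
Circuits m = SignedSet m → Set

record IsOrientedMatroid {m : ℕ} (𝒞 : Circuits m) : Set where
  field
    signed : ∀ X → 𝒞 X → Empty (X ⁺ ∩ X ⁻)
    C0     : ∀ X → 𝒞 X → Nonempty (support X)
    C1     : ∀ X → 𝒞 X → 𝒞 (negate X)
    C2     : ∀ X Y → 𝒞 X → 𝒞 Y → support X ⊆ support Y →
             (X ≡ Y) ⊎ (X ≡ negate Y)
    C3     : ∀ X Y e → 𝒞 X → 𝒞 Y → X ≢ negate Y →
             e ∈ (X ⁺ ∩ Y ⁻) →
             ∃ λ Z → 𝒞 Z × (Z ⁺ ⊆ ((X ⁺ ∪ Y ⁺) - e))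
                         × (Z ⁻ ⊆ ((X ⁻ ∪ Y ⁻) - e))

Loopless : ∀ {m} → Circuits m → Set
Loopless {m} 𝒞 = ∀ X (e : Fin m) → 𝒞 X → support X ≢ ⁅ e ⁆

Positive : ∀ {m} → SignedSet m → Set
Positive X = Empty (X ⁻)

Acyclic : ∀ {m} → Circuits m → Set
Acyclic 𝒞 = ¬ (∃ λ X → 𝒞 X × Positive X)

reorientSet : ∀ {m} → Subset m → SignedSet m → SignedSet m
reorientSet A X = ((X ⁺ ─ A) ∪ (X ⁻ ∩ A) , (X ⁻ ─ A) ∪ (X ⁺ ∩ A))

reorient : ∀ {m} → Subset m → Circuits m → Circuits m
reorient A 𝒞 Z = ∃ λ X → 𝒞 X × Z ≡ reorientSet A X

delete : ∀ {m} → Circuits m → Subset m → Circuits m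
delete 𝒞 S Y = 𝒞 Y × support Y ⊆ ∁ S

contractCand : ∀ {m} → Circuits m → Subset m → Circuits m
contractCand 𝒞 S Z = ∃ λ Y → 𝒞 Y × Z ≡ (Y ⁺ ─ S , Y ⁻ ─ S)

contract : ∀ {m} → Circuits m → Subset m → Circuits m
contract 𝒞 S Z =
  contractCand 𝒞 S Z × Nonempty (support Z) ×
  (∀ W → contractCand 𝒞 S W → Nonempty (support W) →
         support W ⊆ support Z → support Z ⊆ support W)

-- NBC subsets of the underlying matroid (circuits = supports of signed circuits).
-- The broken circuit of X̲ with ≺-maximal element e is X̲ − e.
IsBrokenCircuitOf : ∀ {m} → Circuits m → Subset m → Set
IsBrokenCircuitOf {m} 𝒞 B =
  ∃ λ X → ∃ λ (e : Fin m) → 𝒞 X × e ∈ support X ×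
    (∀ f → f ∈ support X → toℕ f ≤ toℕ e) × B ≡ (support X - e)

NBC : ∀ {m} → Circuits m → Subset m → Set
NBC 𝒞 N = ∀ B → IsBrokenCircuitOf 𝒞 B → ¬ (B ⊆ N)

E : ∀ {m} → ℕ → Subset m
E k = tabulate (λ i → toℕ i <ᵇ k)

Mk : ∀ {m} → Circuits m → ℕ → Subset m → Subset m → Circuits m
Mk 𝒞 k N A = reorient A (contract (delete 𝒞 (E k ─ N)) N)

𝒩 : ∀ {m} → Circuits m → ℕ → Subset m × Subset m → Set
𝒩 𝒞 k (N , A) =
  N ⊆ E k × A ⊆ ∁ (E k) × NBC 𝒞 N × Acyclic (Mk 𝒞 k N A)

-- Graph of ψ_k, where e_k is the element e : Fin m (so k − 1 = toℕ e):
-- Ψ 𝒞 e (N , A) (N' , A')  means  ψ_k (N , A) = (N' , A').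
Ψ : ∀ {m} → Circuits m → Fin m →
    Subset m × Subset m → Subset m × Subset m → Set
Ψ 𝒞 e (N , A) (N' , A') =
    (e ∉ A × Acyclic (reorient ⁅ e ⁆ (Mk 𝒞 (toℕ e) N A))
           × N' ≡ N ∪ ⁅ e ⁆ × A' ≡ A)
  ⊎ (e ∉ A × ¬ Acyclic (reorient ⁅ e ⁆ (Mk 𝒞 (toℕ e) N A))
           × N' ≡ N × A' ≡ A)
  ⊎ (e ∈ A × N' ≡ N × A' ≡ A - e)

-- Write k for toℕ e. Since N ⊆ E_k never contains e_{k+1} = e, the first case of ψ is
-- recognised by e ∈ N', and on it ψ is injective because adding e to sets avoiding e is.
-- The third case is injective because removing e from sets containing e is. The second
-- and third cases have disjoint images: if ψ(N, A) = (N, A) (second case) and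
-- ψ(N, A') = (N, A' − e) (third case) with A = A' − e, then, as reorienting by A' − e
-- and then by {e} is reorienting by A', ₋{e} 𝓜_k(N, A) = 𝓜_k(N, A') is acyclic.
module Submission where

open import Defs
open import Data.Nat using (ℕ; _<ᵇ_)
open import Data.Nat.Properties using (<ᵇ⇒<; <-irrefl)
open import Data.Bool using (Bool; true; false; T)
open import Data.Bool.Properties using (∨-identityʳ)
open import Data.Unit using (tt)
open import Data.Fin using (Fin; toℕ; zero; suc)
open import Data.Fin.Subset using (Subset; _∈_; _∉_; _⊆_; _∪_; _─_; _-_; ⁅_⁆; inside; outside)
open import Data.Fin.Subset.Properties
  using (x∈⁅x⁆; x∈⁅y⁆⇒x≡y; x∈p∪q⁺; ∪-identityʳ; p─⊥≡p; drop-∷-⊆; drop-not-there)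
open import Data.Vec using ([]; _∷_; head; here; there)
open import Data.Vec.Properties using ([]=⇒lookup; lookup∘tabulate)
open import Data.Product using (_×_; _,_; proj₁; proj₂)
open import Data.Sum using (inj₁; inj₂)
open import Data.Empty using (⊥-elim)
open import Relation.Binary.PropositionalEquality
  using (_≡_; _≢_; refl; sym; trans; cong; cong₂; subst; module ≡-Reasoning)

private
  variable
    m : ℕ
    x : Fin m
    p q : Subset m

x∉E[toℕx] : (x : Fin m) → x ∉ E (toℕ x)
x∉E[toℕx] x x∈E = <-irrefl refl (<ᵇ⇒< (toℕ x) (toℕ x) (subst T (sym x<ᵇx) tt))
  where
  x<ᵇx : (toℕ x <ᵇ toℕ x) ≡ true
  x<ᵇx = trans (sym (lookup∘tabulate _ x)) ([]=⇒lookup x∈E)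

p⊆E[toℕx]⇒x∉p : (x : Fin m) → p ⊆ E (toℕ x) → x ∉ p
p⊆E[toℕx]⇒x∉p x p⊆E x∈p = x∉E[toℕx] x (p⊆E x∈p)

q⊆E[toℕx]⇒p∪⁅x⁆≢q : (x : Fin m) → q ⊆ E (toℕ x) → p ∪ ⁅ x ⁆ ≢ q
q⊆E[toℕx]⇒p∪⁅x⁆≢q {p = p} x q⊆E refl = x∉E[toℕx] x (q⊆E (x∈p∪q⁺ {p = p} (inj₂ (x∈⁅x⁆ x))))

x∈p⇒⁅x⁆⊆p : x ∈ p → ⁅ x ⁆ ⊆ p
x∈p⇒⁅x⁆⊆p {x = x} {p = p} x∈p y∈⁅x⁆ = subst (_∈ p) (sym (x∈⁅y⁆⇒x≡y x y∈⁅x⁆)) x∈p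

x∉p⇒p∪⁅x⁆-x≡p : x ∉ p → p ∪ ⁅ x ⁆ - x ≡ p
x∉p⇒p∪⁅x⁆-x≡p {x = zero}  {p = inside ∷ p}  x∉p = ⊥-elim (x∉p here)
x∉p⇒p∪⁅x⁆-x≡p {x = zero}  {p = outside ∷ p} x∉p =
  cong (outside ∷_) (trans (p─⊥≡p (p ∪ _)) (∪-identityʳ p))
x∉p⇒p∪⁅x⁆-x≡p {x = suc x} {p = b ∷ p}       x∉p =
  cong₂ _∷_ (∨-identityʳ b) (x∉p⇒p∪⁅x⁆-x≡p (drop-not-there x∉p))

x∈p⇒p-x∪⁅x⁆≡p : x ∈ p → (p - x) ∪ ⁅ x ⁆ ≡ p
x∈p⇒p-x∪⁅x⁆≡p {x = zero}  {p = inside ∷ p} here =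
  cong (inside ∷_) (trans (∪-identityʳ (p ─ _)) (p─⊥≡p p))
x∈p⇒p-x∪⁅x⁆≡p {x = suc x} {p = b ∷ p} (there x∈p) =
  cong₂ _∷_ (∨-identityʳ b) (x∈p⇒p-x∪⁅x⁆≡p x∈p)

p∪⁅x⁆≡q∪⁅x⁆⇒p≡q : x ∉ p → x ∉ q → p ∪ ⁅ x ⁆ ≡ q ∪ ⁅ x ⁆ → p ≡ q
p∪⁅x⁆≡q∪⁅x⁆⇒p≡q {x = x} {p = p} {q = q} x∉p x∉q eq = begin
  p               ≡⟨ sym (x∉p⇒p∪⁅x⁆-x≡p x∉p) ⟩
  p ∪ ⁅ x ⁆ - x   ≡⟨ cong (_- x) eq ⟩
  q ∪ ⁅ x ⁆ - x   ≡⟨ x∉p⇒p∪⁅x⁆-x≡p x∉q ⟩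
  q               ∎
  where open ≡-Reasoning

p-x≡q-x⇒p≡q : x ∈ p → x ∈ q → p - x ≡ q - x → p ≡ q
p-x≡q-x⇒p≡q {x = x} {p = p} {q = q} x∈p x∈q eq = begin
  p               ≡⟨ sym (x∈p⇒p-x∪⁅x⁆≡p x∈p) ⟩
  (p - x) ∪ ⁅ x ⁆ ≡⟨ cong (_∪ ⁅ x ⁆) eq ⟩
  (q - x) ∪ ⁅ x ⁆ ≡⟨ x∈p⇒p-x∪⁅x⁆≡p x∈q ⟩
  q               ∎
  where open ≡-Reasoning

reorientSet-─-one-point : ∀ (a b p n : Bool) → (b ≡ true → a ≡ true) →
  reorientSet (b ∷ []) (reorientSet ((a ∷ []) ─ (b ∷ [])) (p ∷ [] , n ∷ []))
  ≡ reorientSet (a ∷ []) (p ∷ [] , n ∷ [])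
reorientSet-─-one-point false true  _     _     b⇒a with b⇒a refl
... | ()
reorientSet-─-one-point false false false false _ = refl
reorientSet-─-one-point false false false true  _ = refl
reorientSet-─-one-point false false true  false _ = refl
reorientSet-─-one-point false false true  true  _ = refl
reorientSet-─-one-point true  false false false _ = refl
reorientSet-─-one-point true  false false true  _ = refl
reorientSet-─-one-point true  false true  false _ = refl
reorientSet-─-one-point true  false true  true  _ = refl
reorientSet-─-one-point true  true  false false _ = refl
reorientSet-─-one-point true  true  false true  _ = refl
reorientSet-─-one-point true  true  true  false _ = refl
reorientSet-─-one-point true  true  true  true  _ = refl

-- reorientSet acts coordinatewise, so each coordinate is an instance of the one-point case.
reorientSet-─ : ∀ {A B : Subset m} (X : SignedSet m) → B ⊆ A →
                reorientSet B (reorientSet (A ─ B) X) ≡ reorientSet A X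
reorientSet-─ {A = []}     {B = []}     ([] , [])         _   = refl
reorientSet-─ {A = a ∷ as} {B = b ∷ bs} (p ∷ ps , n ∷ ns) B⊆A =
  cong₂ _,_ (cong₂ _∷_ (cong (λ Y → head (Y ⁺)) first) (cong proj₁ rest))
            (cong₂ _∷_ (cong (λ Y → head (Y ⁻)) first) (cong proj₂ rest))
  where
  first = reorientSet-─-one-point a b p n (λ { refl → []=⇒lookup (B⊆A here) })
  rest  = reorientSet-─ (ps , ns) (drop-∷-⊆ B⊆A)

reorient-─-acyclic : ∀ {A B : Subset m} (𝒞 : Circuits m) → B ⊆ A →
  Acyclic (reorient A 𝒞) → Acyclic (reorient B (reorient (A ─ B) 𝒞))
reorient-─-acyclic 𝒞 B⊆A acyclic (_ , (_ , (X , X∈𝒞 , refl) , refl) , positive) =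
  acyclic (_ , (X , X∈𝒞 , refl) , subst Positive (reorientSet-─ X B⊆A) positive)

lemma2p4 : ∀ {m} (𝒞 : Circuits m) → IsOrientedMatroid 𝒞 → Loopless 𝒞 →
           (e : Fin m) (x y x' y' : Subset m × Subset m) →
           𝒩 𝒞 (toℕ e) x → 𝒩 𝒞 (toℕ e) y →
           Ψ 𝒞 e x x' → Ψ 𝒞 e y y' → x' ≡ y' → x ≡ y
lemma2p4 𝒞 _ _ e (N , A) (N' , A') (P , Q) .(P , Q)
         (N⊆E , _ , _ , acyclic) (N'⊆E , _ , _ , acyclic') ψx ψy refl with ψx | ψy
... | inj₁ (_ , _ , refl , refl) | inj₁ (_ , _ , N∪e≡N'∪e , refl) =
  cong (_, A) (p∪⁅x⁆≡q∪⁅x⁆⇒p≡q (p⊆E[toℕx]⇒x∉p e N⊆E) (p⊆E[toℕx]⇒x∉p e N'⊆E) N∪e≡N'∪e)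
... | inj₁ (_ , _ , refl , refl) | inj₂ (inj₁ (_ , _ , N∪e≡N' , _)) =
  ⊥-elim (q⊆E[toℕx]⇒p∪⁅x⁆≢q e N'⊆E N∪e≡N')
... | inj₁ (_ , _ , refl , refl) | inj₂ (inj₂ (_ , N∪e≡N' , _)) =
  ⊥-elim (q⊆E[toℕx]⇒p∪⁅x⁆≢q e N'⊆E N∪e≡N')
... | inj₂ (inj₁ (_ , _ , refl , refl)) | inj₁ (_ , _ , N'∪e≡N , _) =
  ⊥-elim (q⊆E[toℕx]⇒p∪⁅x⁆≢q e N⊆E (sym N'∪e≡N))
... | inj₂ (inj₂ (_ , refl , refl)) | inj₁ (_ , _ , N'∪e≡N , _) =
  ⊥-elim (q⊆E[toℕx]⇒p∪⁅x⁆≢q e N⊆E (sym N'∪e≡N))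
... | inj₂ (inj₁ (_ , _ , refl , refl)) | inj₂ (inj₁ (_ , _ , refl , refl)) = refl
... | inj₂ (inj₁ (_ , ¬acyclic , refl , refl)) | inj₂ (inj₂ (e∈A' , refl , refl)) =
  ⊥-elim (¬acyclic (reorient-─-acyclic _ (x∈p⇒⁅x⁆⊆p e∈A') acyclic'))
... | inj₂ (inj₂ (e∈A , refl , refl)) | inj₂ (inj₁ (_ , ¬acyclic , refl , refl)) =
  ⊥-elim (¬acyclic (reorient-─-acyclic _ (x∈p⇒⁅x⁆⊆p e∈A) acyclic))
... | inj₂ (inj₂ (e∈A , refl , refl)) | inj₂ (inj₂ (e∈A' , refl , A-e≡A'-e)) =
  cong (N ,_) (p-x≡q-x⇒p≡q e∈A e∈A' A-e≡A'-e)
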